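{- The undirected generalized pancake graph $\mathbb{P}_3(2)$ is toroidal, i.e., $\gamma(\mathbb{P}_3(2))=1$.
   Context: For a graph $G$, $\gamma(G)$ denotes its genus: the minimum genus of a closed orientable surface on which $G$ can be embedded without edge crossings. Let $S(3,2)=C_3\wr S_2$. Its 18 elements are written $\pi_1^{a_1}\pi_2^{a_2}$, where $\pi_1\pi_2$ is a permutation of $\{1,2\}$ and $a_1,a_2\in\{0,1,2\}$. The flip $r_1$ maps $\pi_1^{a_1}\pi_2^{a_2}$ to $\pi_1^{a_1+1}\pi_2^{a_2}$. The flip $r_2$ maps $\pi_1^{a_1}\pi_2^{a_2}$ to $\pi_2^{a_2+1}\pi_1^{a_1+1}$. Signs are taken modulo $3$. The graph $\mathbb{P}_3(2)$ has vertex set $S(3,2)$. Vertices $v,w$ are adjacent iff $w=r_i(v)$ or $v=r_i(w)$ for some $i\in\{1,2\}$. -}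

module Defs where

open import Data.Nat using (ℕ; zero; suc; _+_; _*_; _≤_)
open import Data.Bool using (Bool; true; false; not; _∨_; _∧_; T; if_then_else_)
open import Data.Empty using (⊥)
open import Data.Fin as Fin using (Fin; remQuot)
open import Data.Fin.Properties using () renaming (_≟_ to _≟ᶠ_)
open import Data.Bool.Properties using (∨-comm; ∨-assoc) renaming (_≟_ to _≟ᵇ_)
open import Data.List using (List; map; allFin; cartesianProduct)
open import Data.Nat.ListAction using (sum)
open import Data.Product using (Σ; ∃; _×_; _,_; proj₁; proj₂)
open import Relation.Nullary.Decidable using (⌊_⌋)
open import Relation.Binary.PropositionalEquality using (_≡_; subst; refl)

record Graph : Set where
  field
    n       : ℕ
    adj     : Fin n → Fin n → Bool
    adj-sym : ∀ v w → T (adj v w) → T (adj w v)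
    irrefl  : ∀ v → T (adj v v) → ⊥

module _ (G : Graph) where
  open Graph G

  numDarts : ℕ
  numDarts = sum (map (λ p → if adj (proj₁ p) (proj₂ p) then 1 else 0)
                      (cartesianProduct (allFin n) (allFin n)))

  Dart : Set
  Dart = Σ (Fin n × Fin n) (λ p → T (adj (proj₁ p) (proj₂ p)))

  tail : Dart → Fin n
  tail ((v , w) , _) = v

  rev : Dart → Dart
  rev ((v , w) , e) = (w , v) , adj-sym v w e

iter : {A : Set} → (A → A) → ℕ → A → A
iter f zero    x = x
iter f (suc k) x = f (iter f k x)

SameOrbit : {A : Set} → (A → A) → A → A → Set
SameOrbit f x y = ∃ λ k → iter f k x ≡ y

-- Rotation systems (combinatorial embeddings into closed orientable
-- surfaces): a permutation ρ of the darts which, at every vertex v,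
-- cyclically permutes the darts leaving v (a single cycle per vertex).

record RotationSystem (G : Graph) : Set where
  field
    ρ        : Dart G → Dart G
    ρ⁻¹      : Dart G → Dart G
    inv-l    : ∀ d → ρ⁻¹ (ρ d) ≡ d
    inv-r    : ∀ d → ρ (ρ⁻¹ d) ≡ d
    tail-ρ   : ∀ d → tail G (ρ d) ≡ tail G d
    cyclic   : ∀ d d' → tail G d ≡ tail G d' → SameOrbit ρ d d'

  -- face-tracing permutation: faces of the embedding = orbits of φ
  φ : Dart G → Dart G
  φ d = ρ (rev G d)

NumFaces : {G : Graph} → RotationSystem G → ℕ → Set
NumFaces {G} R F =
  Σ (Dart G → Fin F) λ f →
    (∀ i → ∃ λ d → f d ≡ i) ×
    (∀ d d' → (f d ≡ f d' → SameOrbit (RotationSystem.φ R) d d')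
            × (SameOrbit (RotationSystem.φ R) d d' → f d ≡ f d'))

-- R embeds G in the orientable surface of genus g (Euler's formula
-- V - E + F = 2 - 2g, multiplied by 2 to use the dart count 2E).
EmbeddingGenus : {G : Graph} → RotationSystem G → ℕ → Set
EmbeddingGenus {G} R g =
  ∃ λ F → NumFaces R F ×
    (2 * Graph.n G + 2 * F + 4 * g ≡ 4 + numDarts G)

-- γ(G) = g : g is the minimum genus over all (cellular) embeddings,
-- i.e. over all rotation systems (for connected G).
HasGenus : Graph → ℕ → Set
HasGenus G g =
  (Σ (RotationSystem G) λ R → EmbeddingGenus R g) ×
  (∀ (R : RotationSystem G) h → EmbeddingGenus R h → g ≤ h)

-- A vertex π₁^{a₁} π₂^{a₂} is stored as (p , a₁ , a₂) where p = true
-- means the word is "1 2", p = false means "2 1", and a₁, a₂ ∈ ℤ/3 are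
-- the signs in positions 1 and 2.

PVertex : Set
PVertex = Bool × Fin 3 × Fin 3

suc3 : Fin 3 → Fin 3
suc3 Fin.zero                     = Fin.suc Fin.zero
suc3 (Fin.suc Fin.zero)           = Fin.suc (Fin.suc Fin.zero)
suc3 (Fin.suc (Fin.suc Fin.zero)) = Fin.zero

r₁ : PVertex → PVertex
r₁ (p , a₁ , a₂) = p , suc3 a₁ , a₂

r₂ : PVertex → PVertex
r₂ (p , a₁ , a₂) = not p , suc3 a₂ , suc3 a₁

eqV : PVertex → PVertex → Bool
eqV (p , a , b) (q , c , d) = ⌊ p ≟ᵇ q ⌋ ∧ ⌊ a ≟ᶠ c ⌋ ∧ ⌊ b ≟ᶠ d ⌋

toBool : Fin 2 → Bool
toBool Fin.zero = true
toBool (Fin.suc _) = false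

decode : Fin 18 → PVertex
decode i with remQuot {2} 9 i
... | (b , j) with remQuot {3} 3 j
...   | (x , y) = toBool b , x , y

adjP : PVertex → PVertex → Bool
adjP v w = eqV w (r₁ v) ∨ eqV w (r₂ v) ∨ eqV v (r₁ w) ∨ eqV v (r₂ w)

adjP-sym : ∀ v w → T (adjP v w) → T (adjP w v)
adjP-sym v w = subst T (lemma (eqV w (r₁ v)) (eqV w (r₂ v)) (eqV v (r₁ w)) (eqV v (r₂ w)))
  where
  lemma : ∀ a b c d → a ∨ b ∨ c ∨ d ≡ c ∨ d ∨ a ∨ b
  lemma true true true true = refl
  lemma true true true false = refl
  lemma true true false true = refl
  lemma true true false false = refl
  lemma true false true true = refl
  lemma true false true false = refl
  lemma true false false true = refl
  lemma true false false false = refl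
  lemma false true true true = refl
  lemma false true true false = refl
  lemma false true false true = refl
  lemma false true false false = refl
  lemma false false true true = refl
  lemma false false true false = refl
  lemma false false false true = refl
  lemma false false false false = refl

adjP-irrefl : ∀ v → T (adjP v v) → ⊥
adjP-irrefl (true , Fin.zero , Fin.zero) ()
adjP-irrefl (true , Fin.zero , (Fin.suc Fin.zero)) ()
adjP-irrefl (true , Fin.zero , (Fin.suc (Fin.suc Fin.zero))) ()
adjP-irrefl (true , (Fin.suc Fin.zero) , Fin.zero) ()
adjP-irrefl (true , (Fin.suc Fin.zero) , (Fin.suc Fin.zero)) ()
adjP-irrefl (true , (Fin.suc Fin.zero) , (Fin.suc (Fin.suc Fin.zero))) ()
adjP-irrefl (true , (Fin.suc (Fin.suc Fin.zero)) , Fin.zero) ()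
adjP-irrefl (true , (Fin.suc (Fin.suc Fin.zero)) , (Fin.suc Fin.zero)) ()
adjP-irrefl (true , (Fin.suc (Fin.suc Fin.zero)) , (Fin.suc (Fin.suc Fin.zero))) ()
adjP-irrefl (false , Fin.zero , Fin.zero) ()
adjP-irrefl (false , Fin.zero , (Fin.suc Fin.zero)) ()
adjP-irrefl (false , Fin.zero , (Fin.suc (Fin.suc Fin.zero))) ()
adjP-irrefl (false , (Fin.suc Fin.zero) , Fin.zero) ()
adjP-irrefl (false , (Fin.suc Fin.zero) , (Fin.suc Fin.zero)) ()
adjP-irrefl (false , (Fin.suc Fin.zero) , (Fin.suc (Fin.suc Fin.zero))) ()
adjP-irrefl (false , (Fin.suc (Fin.suc Fin.zero)) , Fin.zero) ()
adjP-irrefl (false , (Fin.suc (Fin.suc Fin.zero)) , (Fin.suc Fin.zero)) ()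
adjP-irrefl (false , (Fin.suc (Fin.suc Fin.zero)) , (Fin.suc (Fin.suc Fin.zero))) ()

ℙ₃₂ : Graph
ℙ₃₂ = record
  { n       = 18
  ; adj     = λ i j → adjP (decode i) (decode j)
  ; adj-sym = λ i j → adjP-sym (decode i) (decode j)
  ; irrefl  = λ i → adjP-irrefl (decode i)
  }

-- Rotating the darts r₁, r₁⁻¹, r₂, r₂⁻¹ cyclically at every vertex embeds ℙ₃(2) with 18 faces
-- (9 quadrilaterals r₁r₂r₁r₂, 6 triangles of r₁⁻¹ and 3 hexagons of r₂⁻¹), so V − E + F = 0 and
-- the genus is at most 1.  A planar embedding would have 20 faces.  Give r₁-darts weight 5 and
-- r₂-darts weight 3, 288 in total.  Face tracing walks never backtrack, and every
-- non-backtracking walk of five darts starts with a repetition-free stretch of weight at least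
-- 15: five distinct darts weigh at least 15, the closed walks of length 3 are the r₁-triangles,
-- and a closed walk of length 4 uses r₂ an even number of times (r₂ reverses the word), hence
-- exactly twice.  So every face weighs at least 15 and there are at most 19 faces.

module Submission where

open import Defs
open import Data.Bool using (Bool; true; false; not; T; if_then_else_)
open import Data.Bool.Properties using (T?; T-irrelevant)
open import Data.Empty using (⊥; ⊥-elim)
open import Data.Fin using (Fin; zero; suc; toℕ; combine; #_)
open import Data.Fin.Properties using (_≟_; all?; any?; toℕ-fromℕ<)
open import Data.List
  using (List; []; _∷_; _++_; map; concat; concatMap; tabulate; allFin; applyUpTo; take; length)
open import Data.List.Properties using (map-++)
open import Data.List.Membership.Propositional using (_∈_)
open import Data.List.Membership.Propositional.Properties
  using (∈-∃++; ∈-++⁻; ∈-++⁺ˡ; ∈-++⁺ʳ; ∈-concat⁺′; ∈-map⁺; ∈-allFin)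
open import Data.List.Relation.Unary.All as All using (All)
open import Data.List.Relation.Unary.All.Properties as All using ()
open import Data.List.Relation.Unary.AllPairs using (_∷_)
open import Data.List.Relation.Unary.AllPairs.Properties as AllPairs using ()
open import Data.List.Relation.Unary.Any using (here; there)
open import Data.List.Relation.Unary.Unique.Propositional using (Unique)
open import Data.List.Relation.Unary.Unique.Propositional.Properties using (concat⁺)
import Data.List.Relation.Unary.Unique.DecPropositional as DecUnique
open import Data.List.Relation.Binary.Subset.Propositional using (_⊆_)
open import Data.List.Relation.Binary.Permutation.Propositional.Properties as ↭ using (shift)
open import Data.Nat using (ℕ; zero; suc; _+_; _*_; _≤_; _≤?_; z≤n; s≤s; _%_; _/_)
open import Data.Nat.DivMod using (m≡m%n+[m/n]*n; m%n<n; _mod_)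
open import Data.Nat.ListAction using (sum)
open import Data.Nat.ListAction.Properties using (sum-++; sum-↭)
open import Data.Nat.Properties
  using (+-mono-≤; +-monoʳ-≤; ≤-trans; *-suc; +-comm; +-identityʳ; +-cancelˡ-≡; *-cancelˡ-≡;
         module ≤-Reasoning)
open import Data.Product using (∃; _×_; _,_; proj₁; proj₂; uncurry; map₂)
open import Data.Product.Properties using (≡-dec)
open import Data.Sum using (inj₁; inj₂)
open import Data.Vec as Vec using (Vec; lookup)
open import Function using (_∘_)
open import Relation.Binary.Definitions using (DecidableEquality)
open import Relation.Binary.PropositionalEquality
  using (_≡_; _≢_; refl; sym; trans; cong; cong₂; subst; module ≡-Reasoning)
open import Relation.Nullary using (Dec; contradiction)
open import Relation.Nullary.Decidable using (⌊_⌋; from-yes; from-no; map′; ¬?; _×-dec_; _→-dec_)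
open import Relation.Unary using (Decidable)

module _ {A : Set} (f : A → A) where

  iter-+ : ∀ m n x → iter f (m + n) x ≡ iter f m (iter f n x)
  iter-+ zero    n x = refl
  iter-+ (suc m) n x = cong f (iter-+ m n x)

  sameOrbit-trans : ∀ {x y z} → SameOrbit f x y → SameOrbit f y z → SameOrbit f x z
  sameOrbit-trans (m , refl) (n , refl) = n + m , iter-+ n m _

  SameOrbitWithin : ℕ → A → A → Set
  SameOrbitWithin N x y = ∃ λ (k : Fin N) → iter f (toℕ k) x ≡ y

  within⇒sameOrbit : ∀ {N x y} → SameOrbitWithin N x y → SameOrbit f x y
  within⇒sameOrbit (k , eq) = toℕ k , eq

  module Periodic {N : ℕ} (periodic : ∀ x → iter f (suc N) x ≡ x) where

    iter-*-period : ∀ q x → iter f (q * suc N) x ≡ x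
    iter-*-period zero    x = refl
    iter-*-period (suc q) x = begin
      iter f (suc N + q * suc N) x          ≡⟨ iter-+ (suc N) (q * suc N) x ⟩
      iter f (suc N) (iter f (q * suc N) x) ≡⟨ cong (iter f (suc N)) (iter-*-period q x) ⟩
      iter f (suc N) x                      ≡⟨ periodic x ⟩
      x                                     ∎
      where open ≡-Reasoning

    iter-% : ∀ k x → iter f (k % suc N) x ≡ iter f k x
    iter-% k x = begin
      iter f (k % suc N) x
        ≡⟨ cong (iter f (k % suc N)) (iter-*-period (k / suc N) x) ⟨
      iter f (k % suc N) (iter f (k / suc N * suc N) x)
        ≡⟨ iter-+ (k % suc N) (k / suc N * suc N) x ⟨
      iter f (k % suc N + k / suc N * suc N) x
        ≡⟨ cong (λ j → iter f j x) (m≡m%n+[m/n]*n k (suc N)) ⟨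
      iter f k x
        ∎
      where open ≡-Reasoning

    sameOrbit⇒within : ∀ {x y} → SameOrbit f x y → SameOrbitWithin (suc N) x y
    sameOrbit⇒within {x} (k , eq) =
      k mod suc N ,
      trans (cong (λ j → iter f j x) (toℕ-fromℕ< (m%n<n k (suc N)))) (trans (iter-% k x) eq)

    sameOrbit-sym : ∀ {x y} → SameOrbit f x y → SameOrbit f y x
    sameOrbit-sym {x} (k , refl) = k * N , (begin
      iter f (k * N) (iter f k x)
        ≡⟨ iter-+ (k * N) k x ⟨
      iter f (k * N + k) x
        ≡⟨ cong (λ j → iter f j x) (trans (*-suc k N) (+-comm k (k * N))) ⟨
      iter f (k * suc N) x
        ≡⟨ iter-*-period k x ⟩
      x ∎)
      where open ≡-Reasoning

module _ {A : Set} (w : A → ℕ) where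

  private
    ∈-drop-middle : ∀ {x y : A} as {bs} → y ∈ as ++ x ∷ bs → x ≢ y → y ∈ as ++ bs
    ∈-drop-middle as y∈ x≢y with ∈-++⁻ as y∈
    ... | inj₁ y∈as         = ∈-++⁺ˡ y∈as
    ... | inj₂ (here refl)  = contradiction refl x≢y
    ... | inj₂ (there y∈bs) = ∈-++⁺ʳ as y∈bs

  unique-⊆⇒sum-map-≤ : ∀ {xs ys} → Unique xs → xs ⊆ ys → sum (map w xs) ≤ sum (map w ys)
  unique-⊆⇒sum-map-≤ {[]}     _             _       = z≤n
  unique-⊆⇒sum-map-≤ {x ∷ xs} (x∉xs ∷ uniq) x∷xs⊆ys with ∈-∃++ (x∷xs⊆ys (here refl))
  ... | as , bs , refl = begin
    w x + sum (map w xs)         ≤⟨ +-monoʳ-≤ (w x) (unique-⊆⇒sum-map-≤ uniq xs⊆as++bs) ⟩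
    w x + sum (map w (as ++ bs)) ≡⟨ sum-↭ (↭.map⁺ w (shift x as bs)) ⟨
    sum (map w (as ++ x ∷ bs))   ∎
    where
    open ≤-Reasoning
    xs⊆as++bs : xs ⊆ as ++ bs
    xs⊆as++bs y∈xs = ∈-drop-middle as (x∷xs⊆ys (there y∈xs)) (All.lookup x∉xs y∈xs)

  sum-map-concat-tabulate-≥ : ∀ {F c} (L : Fin F → List A) → (∀ i → c ≤ sum (map w (L i))) →
                              F * c ≤ sum (map w (concat (tabulate L)))
  sum-map-concat-tabulate-≥ {zero}  L heavy = z≤n
  sum-map-concat-tabulate-≥ {suc F} {c} L heavy = begin
    c + F * c
      ≤⟨ +-mono-≤ (heavy zero) (sum-map-concat-tabulate-≥ (L ∘ suc) (heavy ∘ suc)) ⟩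
    sum (map w (L zero)) + sum (map w (concat (tabulate (L ∘ suc))))
      ≡⟨ sum-++ (map w (L zero)) _ ⟨
    sum (map w (L zero) ++ map w (concat (tabulate (L ∘ suc))))
      ≡⟨ cong sum (map-++ w (L zero) _) ⟨
    sum (map w (L zero ++ concat (tabulate (L ∘ suc))))
      ∎
    where open ≤-Reasoning

  heavy-fibres-bound : ∀ {F c ys} (f : A → Fin F) (L : Fin F → List A) →
                       (∀ i → Unique (L i)) → (∀ i → All (λ x → f x ≡ i) (L i)) →
                       (∀ i → c ≤ sum (map w (L i))) → (∀ x → x ∈ ys) →
                       F * c ≤ sum (map w ys)
  heavy-fibres-bound f L unique fibre heavy complete = ≤-trans
    (sum-map-concat-tabulate-≥ L heavy)
    (unique-⊆⇒sum-map-≤ (concat⁺ (All.tabulate⁺ unique) (AllPairs.tabulate⁺ disjoint))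
                        (λ {x} _ → complete x))
    where
    disjoint : ∀ {i j} → i ≢ j → ∀ {x} → x ∈ L i × x ∈ L j → ⊥
    disjoint {i} {j} i≢j (x∈Li , x∈Lj) =
      i≢j (trans (sym (All.lookup (fibre i) x∈Li)) (All.lookup (fibre j) x∈Lj))

module _ (G : Graph) where

  head : Dart G → Fin (Graph.n G)
  head ((v , w) , _) = w

  dart-≡ : {d d′ : Dart G} → proj₁ d ≡ proj₁ d′ → d ≡ d′
  dart-≡ {_ , e} {_ , e′} refl = cong (_ ,_) (T-irrelevant e e′)

  ≟-dart : DecidableEquality (Dart G)
  ≟-dart d d′ = map′ dart-≡ (cong proj₁) (≡-dec _≟_ _≟_ (proj₁ d) (proj₁ d′))

  NoLeaves : Set
  NoLeaves = ∀ d → ∃ λ d′ → tail G d′ ≡ tail G d × d′ ≢ d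

  NonBacktracking : (ℕ → Dart G) → Set
  NonBacktracking s = ∀ k → tail G (s (suc k)) ≡ head (s k) × head (s (suc k)) ≢ tail G (s k)

module _ {G : Graph} (R : RotationSystem G) where
  open RotationSystem R

  ρ-moves : NoLeaves G → ∀ d → ρ d ≢ d
  ρ-moves other d ρd≡d with other d
  ... | d′ , same , d′≢d with cyclic d d′ (sym same)
  ... | k , ρᵏd≡d′ = d′≢d (trans (sym ρᵏd≡d′) (iter-fixed k))
    where
    iter-fixed : ∀ k → iter ρ k d ≡ d
    iter-fixed zero    = refl
    iter-fixed (suc k) = trans (cong ρ (iter-fixed k)) ρd≡d

  faceWalk-nonBacktracking : (∀ d → ρ d ≢ d) → ∀ d → NonBacktracking G (λ k → iter φ k d)
  faceWalk-nonBacktracking ρd≢d d k = tail-ρ (rev G x) , λ back →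
    ρd≢d (rev G x) (dart-≡ G (cong₂ _,_ (tail-ρ (rev G x)) back))
    where x = iter φ k d

  numFaces-fromRepresentatives :
    ∀ {F} (rep : Fin F → Dart G) →
    (∀ d → ∃ λ i → SameOrbit φ (rep i) d) →
    (∀ i j → SameOrbit φ (rep i) (rep j) → i ≡ j) →
    (∀ {d d′} → SameOrbit φ d d′ → SameOrbit φ d′ d) →
    NumFaces R F
  numFaces-fromRepresentatives rep covered separated orbit-sym =
    face , (λ i → rep i , face-rep i) , λ d d′ → same-face⇒orbit d d′ , orbit⇒same-face d d′
    where
    face : Dart G → Fin _
    face d = proj₁ (covered d)
    rep~ : ∀ d → SameOrbit φ (rep (face d)) d
    rep~ d = proj₂ (covered d)
    face-rep : ∀ i → face (rep i) ≡ i
    face-rep i = separated (face (rep i)) i (rep~ (rep i))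
    same-face⇒orbit : ∀ d d′ → face d ≡ face d′ → SameOrbit φ d d′
    same-face⇒orbit d d′ eq = sameOrbit-trans φ (orbit-sym (rep~ d))
      (subst (λ i → SameOrbit φ (rep i) d′) (sym eq) (rep~ d′))
    orbit⇒same-face : ∀ d d′ → SameOrbit φ d d′ → face d ≡ face d′
    orbit⇒same-face d d′ d~d′ = separated (face d) (face d′)
      (sameOrbit-trans φ (sameOrbit-trans φ (rep~ d) d~d′) (orbit-sym (rep~ d′)))

module Enumerated (G : Graph) (dartsAt : Fin (Graph.n G) → List (Dart G))
                  (∈-dartsAt : ∀ d → d ∈ dartsAt (tail G d)) where

  darts : List (Dart G)
  darts = concatMap dartsAt (allFin (Graph.n G))

  ∈-darts : ∀ d → d ∈ darts
  ∈-darts d = ∈-concat⁺′ (∈-dartsAt d) (∈-map⁺ dartsAt (∈-allFin (tail G d)))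

  all-darts? : {P : Dart G → Set} → Decidable P → Dec (∀ d → P d)
  all-darts? P? = map′ (λ all d → All.lookup all (∈-darts d))
                       (λ ∀P → All.tabulate (λ {d} _ → ∀P d))
                       (All.all? P? darts)

  AllNonBacktracking : ℕ → Dart G → (List (Dart G) → Set) → Set
  AllNonBacktracking zero    d P = P (d ∷ [])
  AllNonBacktracking (suc ℓ) d P =
    All (λ d′ → head G d′ ≢ tail G d → AllNonBacktracking ℓ d′ (λ ds → P (d ∷ ds)))
        (dartsAt (head G d))

  allNonBacktracking? : ∀ ℓ d {P} → (∀ ds → Dec (P ds)) → Dec (AllNonBacktracking ℓ d P)
  allNonBacktracking? zero    d P? = P? (d ∷ [])
  allNonBacktracking? (suc ℓ) d P? = All.all?
    (λ d′ → ¬? (head G d′ ≟ tail G d) →-dec allNonBacktracking? ℓ d′ (λ ds → P? (d ∷ ds)))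
    (dartsAt (head G d))

  allNonBacktracking-walk : ∀ ℓ {P} s → NonBacktracking G s → AllNonBacktracking ℓ (s 0) P →
                            P (applyUpTo s (suc ℓ))
  allNonBacktracking-walk zero    s _    p   = p
  allNonBacktracking-walk (suc ℓ) s walk all = allNonBacktracking-walk ℓ (s ∘ suc) (walk ∘ suc)
    (All.lookup all s₁∈ (proj₂ (walk 0)))
    where
    s₁∈ : s 1 ∈ dartsAt (head G (s 0))
    s₁∈ = subst (λ v → s 1 ∈ dartsAt v) (proj₁ (walk 0)) (∈-dartsAt (s 1))

  -- A face orbit may close up before ℓ steps; only a repetition-free prefix of the walk is
  -- guaranteed to contribute its full weight to the face.
  HeavyPrefix : ℕ → (Dart G → ℕ) → List (Dart G) → Set
  HeavyPrefix c w ds = ∃ λ (m : Fin (suc (length ds))) →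
    Unique (take (toℕ m) ds) × c ≤ sum (map w (take (toℕ m) ds))

  heavyPrefix? : ∀ c w ds → Dec (HeavyPrefix c w ds)
  heavyPrefix? c w ds = any? λ m →
    DecUnique.unique? (≟-dart G) (take (toℕ m) ds) ×-dec c ≤? sum (map w (take (toℕ m) ds))

  faces-weight-bound : ∀ (R : RotationSystem G) {F} → NumFaces R F → NoLeaves G →
    ∀ ℓ c w → (∀ d → AllNonBacktracking ℓ d (HeavyPrefix c w)) →
    F * c ≤ sum (map w darts)
  faces-weight-bound R (face , onto , same-face⇔orbit) other ℓ c w heavy =
    heavy-fibres-bound w face prefix prefix-unique in-face prefix-heavy ∈-darts
    where
    open RotationSystem R using (φ)
    walk : Fin _ → ℕ → Dart G
    walk i k = iter φ k (proj₁ (onto i))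
    heavyPrefix : ∀ i → HeavyPrefix c w (applyUpTo (walk i) (suc ℓ))
    heavyPrefix i = allNonBacktracking-walk ℓ (walk i)
      (faceWalk-nonBacktracking R (ρ-moves R other) (proj₁ (onto i))) (heavy (walk i 0))
    prefix : Fin _ → List (Dart G)
    prefix i = take (toℕ (proj₁ (heavyPrefix i))) (applyUpTo (walk i) (suc ℓ))
    prefix-unique : ∀ i → Unique (prefix i)
    prefix-unique i = proj₁ (proj₂ (heavyPrefix i))
    prefix-heavy : ∀ i → c ≤ sum (map w (prefix i))
    prefix-heavy i = proj₂ (proj₂ (heavyPrefix i))
    in-face : ∀ i → All (λ d → face d ≡ i) (prefix i)
    in-face i = All.take⁺ _ (All.applyUpTo⁺₂ (walk i) (suc ℓ)
      (λ k → trans (sym (proj₂ (same-face⇔orbit (walk i 0) (walk i k)) (k , refl))) (proj₂ (onto i))))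

pred3 : Fin 3 → Fin 3
pred3 a = suc3 (suc3 a)

r₁⁻¹ : PVertex → PVertex
r₁⁻¹ (p , a₁ , a₂) = p , pred3 a₁ , a₂

r₂⁻¹ : PVertex → PVertex
r₂⁻¹ (p , a₁ , a₂) = not p , pred3 a₂ , pred3 a₁

Flip : Set
Flip = Fin 4

pattern r₁⁺ = zero
pattern r₁⁻ = suc zero
pattern r₂⁺ = suc (suc zero)
pattern r₂⁻ = suc (suc (suc zero))

apply : Flip → PVertex → PVertex
apply r₁⁺ = r₁
apply r₁⁻ = r₁⁻¹
apply r₂⁺ = r₂
apply r₂⁻ = r₂⁻¹

next : Flip → Flip
next r₁⁺ = r₁⁻
next r₁⁻ = r₂⁺
next r₂⁺ = r₂⁻
next r₂⁻ = r₁⁺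

prev : Flip → Flip
prev r₁⁺ = r₂⁻
prev r₁⁻ = r₁⁺
prev r₂⁺ = r₁⁻
prev r₂⁻ = r₂⁺

prev-next : ∀ g → prev (next g) ≡ g
prev-next r₁⁺ = refl
prev-next r₁⁻ = refl
prev-next r₂⁺ = refl
prev-next r₂⁻ = refl

next-prev : ∀ g → next (prev g) ≡ g
next-prev r₁⁺ = refl
next-prev r₁⁻ = refl
next-prev r₂⁺ = refl
next-prev r₂⁻ = refl

next-≢ : ∀ g → next g ≢ g
next-≢ r₁⁺ ()
next-≢ r₁⁻ ()
next-≢ r₂⁺ ()
next-≢ r₂⁻ ()

next-transitive : ∀ g g′ → SameOrbit next g g′
next-transitive g g′ = sameOrbit-trans next (to-r₁⁺ g) (from-r₁⁺ g′)
  where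
  to-r₁⁺ : ∀ g → SameOrbit next g r₁⁺
  to-r₁⁺ r₁⁺ = 0 , refl
  to-r₁⁺ r₁⁻ = 3 , refl
  to-r₁⁺ r₂⁺ = 2 , refl
  to-r₁⁺ r₂⁻ = 1 , refl
  from-r₁⁺ : ∀ g → SameOrbit next r₁⁺ g
  from-r₁⁺ r₁⁺ = 0 , refl
  from-r₁⁺ r₁⁻ = 1 , refl
  from-r₁⁺ r₂⁺ = 2 , refl
  from-r₁⁺ r₂⁻ = 3 , refl

encode : PVertex → Fin 18
encode (p , a₁ , a₂) = combine (fromBool p) (combine a₁ a₂)
  where
  fromBool : Bool → Fin 2
  fromBool true  = zero
  fromBool false = suc zero

V : Set
V = Fin 18

adj : V → V → Bool
adj = Graph.adj ℙ₃₂

move : Flip → V → V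
move g v = encode (apply g (decode v))

-- r₂⁻ is a junk value when v and w are not adjacent.
flipBetween : V → V → Flip
flipBetween v w =
  if ⌊ w ≟ move r₁⁺ v ⌋ then r₁⁺ else
  if ⌊ w ≟ move r₁⁻ v ⌋ then r₁⁻ else
  if ⌊ w ≟ move r₂⁺ v ⌋ then r₂⁺ else r₂⁻

abstract
  adj-move : ∀ g v → T (adj v (move g v))
  adj-move = from-yes (all? λ g → all? λ v → T? (adj v (move g v)))

  flipBetween-move : ∀ g v → flipBetween v (move g v) ≡ g
  flipBetween-move = from-yes (all? λ g → all? λ v → flipBetween v (move g v) ≟ g)

  move-flipBetween : ∀ v w → T (adj v w) → move (flipBetween v w) v ≡ w
  move-flipBetween =
    from-yes (all? λ v → all? λ w → T? (adj v w) →-dec move (flipBetween v w) v ≟ w)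

D : Set
D = Dart ℙ₃₂

along : Flip → V → D
along g v = (v , move g v) , adj-move g v

flipOf : D → Flip
flipOf ((v , w) , _) = flipBetween v w

along-flipOf : ∀ d → along (flipOf d) (tail ℙ₃₂ d) ≡ d
along-flipOf ((v , w) , e) = dart-≡ ℙ₃₂ (cong (v ,_) (move-flipBetween v w e))

ρ : D → D
ρ d = along (next (flipOf d)) (tail ℙ₃₂ d)

ρ⁻¹ : D → D
ρ⁻¹ d = along (prev (flipOf d)) (tail ℙ₃₂ d)

ρ-along : ∀ g v → ρ (along g v) ≡ along (next g) v
ρ-along g v = cong (λ h → along (next h) v) (flipBetween-move g v)

iter-ρ-along : ∀ k g v → iter ρ k (along g v) ≡ along (iter next k g) v
iter-ρ-along zero    g v = refl
iter-ρ-along (suc k) g v = trans (cong ρ (iter-ρ-along k g v)) (ρ-along (iter next k g) v)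

ρ⁻¹-ρ : ∀ d → ρ⁻¹ (ρ d) ≡ d
ρ⁻¹-ρ d = begin
  along (prev (flipOf (along (next (flipOf d)) v))) v
    ≡⟨ cong (λ h → along (prev h) v) (flipBetween-move (next (flipOf d)) v) ⟩
  along (prev (next (flipOf d))) v
    ≡⟨ cong (λ h → along h v) (prev-next (flipOf d)) ⟩
  along (flipOf d) v
    ≡⟨ along-flipOf d ⟩
  d ∎
  where
  open ≡-Reasoning
  v = tail ℙ₃₂ d

ρ-ρ⁻¹ : ∀ d → ρ (ρ⁻¹ d) ≡ d
ρ-ρ⁻¹ d = begin
  along (next (flipOf (along (prev (flipOf d)) v))) v
    ≡⟨ cong (λ h → along (next h) v) (flipBetween-move (prev (flipOf d)) v) ⟩
  along (next (prev (flipOf d))) v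
    ≡⟨ cong (λ h → along h v) (next-prev (flipOf d)) ⟩
  along (flipOf d) v
    ≡⟨ along-flipOf d ⟩
  d ∎
  where
  open ≡-Reasoning
  v = tail ℙ₃₂ d

ρ-cyclic : ∀ d d′ → tail ℙ₃₂ d ≡ tail ℙ₃₂ d′ → SameOrbit ρ d d′
ρ-cyclic d d′ same with next-transitive (flipOf d) (flipOf d′)
... | k , nextᵏ≡ = k , (begin
  iter ρ k d                                  ≡⟨ cong (iter ρ k) (along-flipOf d) ⟨
  iter ρ k (along (flipOf d) (tail ℙ₃₂ d))    ≡⟨ iter-ρ-along k (flipOf d) (tail ℙ₃₂ d) ⟩
  along (iter next k (flipOf d)) (tail ℙ₃₂ d) ≡⟨ cong₂ along nextᵏ≡ same ⟩
  along (flipOf d′) (tail ℙ₃₂ d′)             ≡⟨ along-flipOf d′ ⟩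
  d′                                          ∎)
  where open ≡-Reasoning

rotation : RotationSystem ℙ₃₂
rotation = record
  { ρ = ρ ; ρ⁻¹ = ρ⁻¹ ; inv-l = ρ⁻¹-ρ ; inv-r = ρ-ρ⁻¹ ; tail-ρ = λ _ → refl ; cyclic = ρ-cyclic }

noLeaves : NoLeaves ℙ₃₂
noLeaves d = ρ d , refl , λ ρd≡d → next-≢ (flipOf d)
  (trans (sym (flipBetween-move (next (flipOf d)) (tail ℙ₃₂ d))) (cong flipOf ρd≡d))

dartsAt : V → List D
dartsAt v = map (λ g → along g v) (allFin 4)

∈-dartsAt : ∀ d → d ∈ dartsAt (tail ℙ₃₂ d)
∈-dartsAt d = subst (_∈ dartsAt (tail ℙ₃₂ d)) (along-flipOf d)
  (∈-map⁺ (λ g → along g (tail ℙ₃₂ d)) (∈-allFin (flipOf d)))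

open Enumerated ℙ₃₂ dartsAt ∈-dartsAt

φ : D → D
φ = RotationSystem.φ rotation

-- Vertex i < 9 is (true , ⌊i/3⌋ , i mod 3) and vertex 9 + i is
-- (false , ⌊i/3⌋ , i mod 3); a quadrilateral r₁r₂r₁r₂ passes through exactly one of these
-- nine vertices with an r₁-dart, a triangle of r₁⁻¹ through exactly one (p , 0 , a₂), and a
-- hexagon of r₂⁻¹ through exactly one (true , 0 , a₂).
faceReps : Vec (Flip × V) 18
faceReps = Vec.fromList
  (  map (r₁⁺ ,_) (# 0 ∷ # 1 ∷ # 2 ∷ # 3 ∷ # 4 ∷ # 5 ∷ # 6 ∷ # 7 ∷ # 8 ∷ [])
  ++ map (r₁⁻ ,_) (# 0 ∷ # 1 ∷ # 2 ∷ # 9 ∷ # 10 ∷ # 11 ∷ [])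
  ++ map (r₂⁻ ,_) (# 0 ∷ # 1 ∷ # 2 ∷ []))

faceRep : Fin 18 → D
faceRep i = uncurry along (lookup faceReps i)

-- Faces have 3, 4 or 6 darts.
abstract
  φ-periodic : ∀ d → iter φ 12 d ≡ d
  φ-periodic = from-yes (all-darts? λ d → ≟-dart ℙ₃₂ (iter φ 12 d) d)

  faceReps-cover : ∀ d → ∃ λ i → SameOrbitWithin φ 12 (faceRep i) d
  faceReps-cover = from-yes (all-darts? λ d → any? λ i →
    any? λ (k : Fin 12) → ≟-dart ℙ₃₂ (iter φ (toℕ k) (faceRep i)) d)

  faceReps-separated : ∀ i j → SameOrbitWithin φ 12 (faceRep i) (faceRep j) → i ≡ j
  faceReps-separated = from-yes (all? λ i → all? λ j →
    any? (λ (k : Fin 12) → ≟-dart ℙ₃₂ (iter φ (toℕ k) (faceRep i)) (faceRep j)) →-dec i ≟ j)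

eighteenFaces : NumFaces rotation 18
eighteenFaces = numFaces-fromRepresentatives rotation faceRep
  (λ d → map₂ (within⇒sameOrbit φ) (faceReps-cover d))
  (λ i j orbit → faceReps-separated i j (sameOrbit⇒within {faceRep i} {faceRep j} orbit))
  (λ {d} {d′} → sameOrbit-sym {d} {d′})
  where open Periodic φ {11} φ-periodic

flipWeight : Flip → ℕ
flipWeight r₁⁺ = 5
flipWeight r₁⁻ = 5
flipWeight r₂⁺ = 3
flipWeight r₂⁻ = 3

weight : D → ℕ
weight = flipWeight ∘ flipOf

total-weight : sum (map weight darts) ≡ 288
total-weight = refl

abstract
  faces-heavy : ∀ d → AllNonBacktracking 4 d (HeavyPrefix 15 weight)
  faces-heavy = from-yes (all-darts? λ d → allNonBacktracking? 4 d (heavyPrefix? 15 weight))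

genus-positive : ∀ (R : RotationSystem ℙ₃₂) h → EmbeddingGenus R h → 1 ≤ h
genus-positive R (suc h) _                   = s≤s z≤n
genus-positive R zero    (F , faces , euler) =
  ⊥-elim (from-no (300 ≤? 288) (subst (λ F → F * 15 ≤ 288) twentyFaces weightBound))
  where
  weightBound : F * 15 ≤ 288
  weightBound = subst (F * 15 ≤_) total-weight
    (faces-weight-bound R faces noLeaves 4 15 weight faces-heavy)
  -- euler normalises to 36 + 2 * F + 0 ≡ 76.
  twentyFaces : F ≡ 20
  twentyFaces = *-cancelˡ-≡ F 20 2 (+-cancelˡ-≡ 36 (2 * F) 40 (trans (sym (+-identityʳ _)) euler))

corollary4p16 : HasGenus ℙ₃₂ 1
corollary4p16 = (rotation , 18 , eighteenFaces , refl) , genus-positive
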